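{- Let $a,b$ be integers (possibly depending on $n$) with $0\leq b<a\leq n$ and let $g=a-b$. Define the partial Boolean function $GapThr_{a,b}$ on $\{0,1\}^n$ by $GapThr_{a,b}(x)=1$ if $|x|\geq a$ and $GapThr_{a,b}(x)=0$ if $|x|\leq b$ (undefined otherwise). Then the block sensitivity satisfies $bs(GapThr_{a,b})=\Theta(n/g)$.
   Context: $|x|$ denotes the Hamming weight (number of ones) of $x\in\{0,1\}^n$. For a (partial) function $f$ on $\{0,1\}^n$, an input $x$ in its domain, and a set $B\subseteq\{1,\dots,n\}$ (a block), $x^B$ denotes the string obtained from $x$ by flipping the bits indexed by $B$; $f$ is sensitive to $B$ on $x$ if $f(x)\neq f(x^B)$ (with $x^B$ in the domain of $f$). The block sensitivity $bs_x(f)$ is the maximum number $t$ of pairwise disjoint blocks $B_1,\dots,B_t$ such that $f$ is sensitive to each $B_i$ on $x$, and $bs(f)$ is the maximum of $bs_x(f)$ over all inputs $x$ in the domain of $f$. -}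

module Defs where

open import Data.Nat using (ℕ; _≤_; _>_; _∸_; _*_)
open import Data.Bool using (Bool; true; false; not; _xor_; if_then_else_)
open import Data.Maybe using (Maybe; just; nothing)
open import Data.Fin using (Fin)
open import Data.Fin.Subset using (Subset; _∈_; ∣_∣)
open import Data.Vec using (zipWith)
open import Data.Nat using (_≤ᵇ_)
open import Data.Product using (Σ; _×_)
open import Data.Empty using (⊥)
open import Relation.Binary.PropositionalEquality using (_≡_; _≢_)

-- Inputs x ∈ {0,1}^n are represented as Vec Bool n (= Subset n);
-- the Hamming weight |x| is the cardinality ∣ x ∣ (number of trues).
Input : ℕ → Set
Input n = Subset n

PartialFn : ℕ → Set
PartialFn n = Input n → Maybe Bool

flip : ∀ {n} → Input n → Subset n → Input n
flip x B = zipWith _xor_ x B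

Sensitive : ∀ {n} → PartialFn n → Input n → Subset n → Set
Sensitive f x B = Σ Bool λ v → (f x ≡ just v) × (f (flip x B) ≡ just (not v))

Disjoint : ∀ {n} → Subset n → Subset n → Set
Disjoint B C = ∀ i → i ∈ B → i ∈ C → ⊥

SensitiveFamily : ∀ {n} → PartialFn n → Input n → (t : ℕ) → (Fin t → Subset n) → Set
SensitiveFamily f x t Bs =
  (∀ i j → i ≢ j → Disjoint (Bs i) (Bs j)) × (∀ i → Sensitive f x (Bs i))

BsAtLeast : ∀ {n} → PartialFn n → Input n → ℕ → Set
BsAtLeast {n} f x t = Σ (Fin t → Subset n) λ Bs → SensitiveFamily f x t Bs

-- IsBS f k : k = bs(f), the maximum over inputs x in the domain of bs_x(f).
-- (Any x admitting a sensitive block lies in the domain of f.)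
IsBS : ∀ {n} → PartialFn n → ℕ → Set
IsBS {n} f k =
  Σ (Input n) (λ x → Σ Bool (λ v → f x ≡ just v) × BsAtLeast f x k)
  × (∀ (x : Input n) (t : ℕ) → BsAtLeast f x t → t ≤ k)

gapThr : ∀ {n} → ℕ → ℕ → PartialFn n
gapThr a b x =
  if a ≤ᵇ ∣ x ∣ then just true
  else if ∣ x ∣ ≤ᵇ b then just false
  else nothing

--     bs(GapThr_{a,b}) = max (⌊a / g⌋ , ⌊(n - b) / g⌋).
--
-- Flipping a block B changes the weight by |∁x ∩ B| - |x ∩ B|.
-- If x has weight w ≥ a, a sensitive block must bring the weight down to ≤ b,
-- so it contains at least w - b ones of x; by a packing argument t disjoint
-- such blocks give t (w - b) ≤ w, whence t g ≤ a.  Dually, on an input of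
-- weight w ≤ b each sensitive block contains at least a - w zeros of x, giving
-- t (a - w) ≤ n - w and hence t g ≤ n - b.
--
-- Any set of size ≥ q g contains q pairwise disjoint blocks of
-- size g.  Taking them inside the ones of an input of weight a (resp. inside
-- the zeros of an input of weight b) gives ⌊a / g⌋ (resp. ⌊(n - b) / g⌋)
-- sensitive blocks.
module Submission where

open import Defs
open import Data.Bool using (Bool; true; false; not)
open import Data.Fin using (Fin; zero; suc)
open import Data.Fin.Properties using (suc-injective)
open import Data.Fin.Subset using (Subset; _∈_; _∉_; _⊆_; ∣_∣; ∁; _∩_; ⊥; ⊤; Empty)
open import Data.Fin.Subset.Properties
  using ( ⊆-antisym; p∩q⊆q; x∈p∩q⁺; x∈p∩q⁻; x∈∁p⇒x∉p; x∉p⇒x∈∁p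
        ; Empty-unique; ∣⊥∣≡0; ⊥⊆; ∣⊤∣≡n; ∣∁p∣≡n∸∣p∣; out⊆; in⊆in)
open import Data.Maybe using (just)
open import Data.Maybe.Properties using (just-injective)
open import Data.Nat using (ℕ; zero; suc; _+_; _*_; _∸_; _≤_; _<_; _⊔_; z≤n; s≤s; _≤ᵇ_; NonZero; >-nonZero)
open import Data.Nat.Properties
  using ( +-comm; +-suc; +-identityʳ; *-comm; *-identityˡ; *-distribˡ-+; *-distribʳ-⊔
        ; ≤-reflexive; ≤-trans; <⇒≤; ≤-<-trans; ≤⇒≯; module ≤-Reasoning
        ; +-mono-≤; +-monoˡ-≤; +-monoʳ-≤; +-monoˡ-<; *-monoˡ-≤
        ; +-cancelˡ-≤; +-cancelʳ-≤; +-cancelʳ-≡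
        ; m≤m+n; m∸n≤m; m≤n+m∸n; m∸n+n≡m; m+[n∸m]≡n; +-∸-assoc; m≤n+o⇒m∸n≤o; m<n⇒0<n∸m
        ; ⊔-sel; ⊔-mono-≤; ⊔-lub; m≤m⊔n; m≤n⊔m; ≤ᵇ-reflects-≤)
open import Data.Nat.Tactic.RingSolver using (solve-∀)
open import Data.Nat.DivMod using (_/_; _%_; m/n*n≤m; m*n/n≡m; m≥n⇒m/n>0; /-monoˡ-≤; m≡m%n+[m/n]*n; m%n<n)
open import Data.Product using (Σ; _×_; _,_; proj₁; proj₂)
open import Data.Sum using (_⊎_; inj₁; inj₂)
open import Data.Vec using ([]; _∷_)
open import Function using (_∘_)
open import Relation.Binary.PropositionalEquality
open import Relation.Nullary using (contradiction)
open import Relation.Nullary.Reflects using (ofʸ; ofⁿ)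

private
  variable
    n : ℕ

∣∩∣+∣∩∁∣≡∣∣ : (p q : Subset n) → ∣ p ∩ q ∣ + ∣ p ∩ ∁ q ∣ ≡ ∣ p ∣
∣∩∣+∣∩∁∣≡∣∣ []          []          = refl
∣∩∣+∣∩∁∣≡∣∣ (true ∷ p)  (true ∷ q)  = cong suc (∣∩∣+∣∩∁∣≡∣∣ p q)
∣∩∣+∣∩∁∣≡∣∣ (true ∷ p)  (false ∷ q) = trans (+-suc _ _) (cong suc (∣∩∣+∣∩∁∣≡∣∣ p q))
∣∩∣+∣∩∁∣≡∣∣ (false ∷ p) (_ ∷ q)     = ∣∩∣+∣∩∁∣≡∣∣ p q

flip-weight : (x B : Subset n) → ∣ flip x B ∣ + ∣ x ∩ B ∣ ≡ ∣ x ∣ + ∣ ∁ x ∩ B ∣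
flip-weight []          []          = refl
flip-weight (true ∷ x)  (true ∷ B)  = trans (+-suc _ _) (cong suc (flip-weight x B))
flip-weight (true ∷ x)  (false ∷ B) = cong suc (flip-weight x B)
flip-weight (false ∷ x) (true ∷ B)  = trans (cong suc (flip-weight x B)) (sym (+-suc _ _))
flip-weight (false ∷ x) (false ∷ B) = flip-weight x B

∣∩∣≡0 : {p q : Subset n} → Disjoint p q → ∣ p ∩ q ∣ ≡ 0
∣∩∣≡0 {n} {p} {q} p#q = trans (cong ∣_∣ (Empty-unique no-point)) (∣⊥∣≡0 n)
  where
  no-point : Empty (p ∩ q)
  no-point (i , i∈p∩q) with x∈p∩q⁻ p q i∈p∩q
  ... | i∈p , i∈q = p#q i i∈p i∈q

∣∩⊇∣ : {p q : Subset n} → q ⊆ p → ∣ p ∩ q ∣ ≡ ∣ q ∣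
∣∩⊇∣ {p = p} {q} q⊆p =
  cong ∣_∣ (⊆-antisym (p∩q⊆q p q) (λ i∈q → x∈p∩q⁺ (q⊆p i∈q , i∈q)))

∣∩∁∩∣ : (p : Subset n) {q r : Subset n} → Disjoint q r → ∣ (p ∩ ∁ q) ∩ r ∣ ≡ ∣ p ∩ r ∣
∣∩∁∩∣ p {q} {r} q#r = cong ∣_∣ (⊆-antisym shrink grow)
  where
  shrink : (p ∩ ∁ q) ∩ r ⊆ p ∩ r
  shrink i∈ with x∈p∩q⁻ _ r i∈
  ... | i∈p∩∁q , i∈r = x∈p∩q⁺ (proj₁ (x∈p∩q⁻ p _ i∈p∩∁q) , i∈r)
  grow : p ∩ r ⊆ (p ∩ ∁ q) ∩ r
  grow {i} i∈ with x∈p∩q⁻ p r i∈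
  ... | i∈p , i∈r = x∈p∩q⁺ (x∈p∩q⁺ (i∈p , x∉p⇒x∈∁p (λ i∈q → q#r i i∈q i∈r)) , i∈r)

flip-⊆ : {x B : Subset n} → B ⊆ x → ∣ flip x B ∣ + ∣ B ∣ ≡ ∣ x ∣
flip-⊆ {x = x} {B} B⊆x = begin
  ∣ flip x B ∣ + ∣ B ∣         ≡⟨ cong (∣ flip x B ∣ +_) (∣∩⊇∣ B⊆x) ⟨
  ∣ flip x B ∣ + ∣ x ∩ B ∣     ≡⟨ flip-weight x B ⟩
  ∣ x ∣ + ∣ ∁ x ∩ B ∣          ≡⟨ cong (∣ x ∣ +_) (∣∩∣≡0 λ i i∈∁x i∈B → x∈∁p⇒x∉p i∈∁x (B⊆x i∈B)) ⟩
  ∣ x ∣ + 0                    ≡⟨ +-identityʳ _ ⟩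
  ∣ x ∣                        ∎
  where open ≡-Reasoning

flip-⊆∁ : {x B : Subset n} → B ⊆ ∁ x → ∣ flip x B ∣ ≡ ∣ x ∣ + ∣ B ∣
flip-⊆∁ {x = x} {B} B⊆∁x = begin
  ∣ flip x B ∣                 ≡⟨ +-identityʳ _ ⟨
  ∣ flip x B ∣ + 0             ≡⟨ cong (∣ flip x B ∣ +_) (∣∩∣≡0 λ i i∈x i∈B → x∈∁p⇒x∉p (B⊆∁x i∈B) i∈x) ⟨
  ∣ flip x B ∣ + ∣ x ∩ B ∣     ≡⟨ flip-weight x B ⟩
  ∣ x ∣ + ∣ ∁ x ∩ B ∣          ≡⟨ cong (∣ x ∣ +_) (∣∩⊇∣ B⊆∁x) ⟩
  ∣ x ∣ + ∣ B ∣                ∎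
  where open ≡-Reasoning

PairwiseDisjoint : {t : ℕ} → (Fin t → Subset n) → Set
PairwiseDisjoint {t = t} Bs = (i j : Fin t) → i ≢ j → Disjoint (Bs i) (Bs j)

packing : ∀ t m (y : Subset n) (Bs : Fin t → Subset n) →
          PairwiseDisjoint Bs → (∀ i → m ≤ ∣ y ∩ Bs i ∣) → t * m ≤ ∣ y ∣
packing zero    m y Bs disj meets = z≤n
packing {n} (suc t) m y Bs disj meets = begin
  m + t * m                 ≤⟨ +-mono-≤ (meets zero) (packing t m y′ (Bs ∘ suc) disj′ meets′) ⟩
  ∣ y ∩ Bs zero ∣ + ∣ y′ ∣  ≡⟨ ∣∩∣+∣∩∁∣≡∣∣ y (Bs zero) ⟩
  ∣ y ∣                     ∎
  where
  open ≤-Reasoning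
  y′ : Subset n
  y′ = y ∩ ∁ (Bs zero)
  disj′ : PairwiseDisjoint (Bs ∘ suc)
  disj′ i j i≢j = disj (suc i) (suc j) (i≢j ∘ suc-injective)
  meets′ : ∀ i → m ≤ ∣ y′ ∩ Bs (suc i) ∣
  meets′ i = subst (m ≤_) (sym (∣∩∁∩∣ y (disj zero (suc i) λ ()))) (meets (suc i))

subset-of-size : (S : Subset n) (c : ℕ) → c ≤ ∣ S ∣ → Σ (Subset n) λ B → B ⊆ S × ∣ B ∣ ≡ c
subset-of-size {n} S       zero    _         = ⊥ , ⊥⊆ , ∣⊥∣≡0 n
subset-of-size (false ∷ S) (suc c) c<∣S∣     with subset-of-size S (suc c) c<∣S∣
... | B , B⊆S , ∣B∣≡c = false ∷ B , out⊆ B⊆S , ∣B∣≡c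
subset-of-size (true ∷ S)  (suc c) (s≤s c≤∣S∣) with subset-of-size S c c≤∣S∣
... | B , B⊆S , ∣B∣≡c = true ∷ B , in⊆in B⊆S , cong suc ∣B∣≡c

BlockFamily : (q g : ℕ) → Subset n → Set
BlockFamily {n} q g S =
  Σ (Fin q → Subset n) λ Bs → PairwiseDisjoint Bs × (∀ i → Bs i ⊆ S × ∣ Bs i ∣ ≡ g)

blocks : ∀ q g (S : Subset n) → q * g ≤ ∣ S ∣ → BlockFamily q g S
blocks zero    g S _    = (λ ()) , (λ ()) , (λ ())
blocks (suc q) g S room with subset-of-size S g (≤-trans (m≤m+n g (q * g)) room)
... | B , B⊆S , ∣B∣≡g = extend (blocks q g (S ∩ ∁ B) room′)
  where
  ∣rest∣ : g + ∣ S ∩ ∁ B ∣ ≡ ∣ S ∣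
  ∣rest∣ = trans (cong (_+ ∣ S ∩ ∁ B ∣) (trans (sym ∣B∣≡g) (sym (∣∩⊇∣ B⊆S)))) (∣∩∣+∣∩∁∣≡∣∣ S B)
  room′ : q * g ≤ ∣ S ∩ ∁ B ∣
  room′ = +-cancelˡ-≤ g _ _ (subst (g + q * g ≤_) (sym ∣rest∣) room)
  -- The rest lies in S ∩ ∁ B, hence is disjoint from B.
  extend : BlockFamily q g (S ∩ ∁ B) → BlockFamily (suc q) g S
  extend (Bs , disj , props) = family , disj′ , props′
    where
    family : Fin (suc q) → Subset _
    family zero    = B
    family (suc i) = Bs i
    outside-B : ∀ i {j} → j ∈ Bs i → j ∉ B
    outside-B i j∈Bs j∈B =
      x∈∁p⇒x∉p (proj₂ (x∈p∩q⁻ S _ (proj₁ (props i) j∈Bs))) j∈B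
    disj′ : PairwiseDisjoint family
    disj′ zero    zero    0≢0 = contradiction refl 0≢0
    disj′ zero    (suc j) _   l l∈B l∈Bs = outside-B j l∈Bs l∈B
    disj′ (suc i) zero    _   l l∈Bs l∈B = outside-B i l∈Bs l∈B
    disj′ (suc i) (suc j) i≢j = disj i j (i≢j ∘ cong suc)
    props′ : ∀ i → family i ⊆ S × ∣ family i ∣ ≡ g
    props′ zero    = B⊆S , ∣B∣≡g
    props′ (suc i) = (λ l∈ → proj₁ (x∈p∩q⁻ S _ (proj₁ (props i) l∈))) , proj₂ (props i)

input-of-weight : (c : ℕ) → c ≤ n → Σ (Input n) λ x → ∣ x ∣ ≡ c
input-of-weight {n} c c≤n with subset-of-size ⊤ c (subst (c ≤_) (sym (∣⊤∣≡n n)) c≤n)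
... | x , _ , ∣x∣≡c = x , ∣x∣≡c

∸-split : ∀ {p q r} → p ≤ q → q ≤ r → r ∸ p ≡ (r ∸ q) + (q ∸ p)
∸-split {p} {q} {r} p≤q q≤r = begin
  r ∸ p                 ≡⟨ cong (_∸ p) (m∸n+n≡m q≤r) ⟨
  (r ∸ q) + q ∸ p       ≡⟨ +-∸-assoc (r ∸ q) p≤q ⟩
  (r ∸ q) + (q ∸ p)     ∎
  where open ≡-Reasoning

-- A common excess e on both sides can be dropped (for t = 0 trivially, and
-- for t ≥ 1 because t * e ≥ e).
cancel-excess : ∀ t g e M → t * (g + e) ≤ M + e → t * g ≤ M
cancel-excess zero    g e M _ = z≤n
cancel-excess (suc t) g e M h = +-cancelʳ-≤ e (suc t * g) M (begin
  suc t * g + e         ≤⟨ +-monoʳ-≤ (suc t * g) (m≤m+n e (t * e)) ⟩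
  suc t * g + suc t * e ≡⟨ *-distribˡ-+ (suc t) g e ⟨
  suc t * (g + e)       ≤⟨ h ⟩
  M + e                 ∎)
  where open ≤-Reasoning

≤-quotient : ∀ t g M .{{_ : NonZero g}} → t * g ≤ M → t ≤ M / g
≤-quotient t g M tg≤M = subst (_≤ M / g) (m*n/n≡m t g) (/-monoˡ-≤ g tg≤M)

<quotient-succ : ∀ M g .{{_ : NonZero g}} → M < g + M / g * g
<quotient-succ M g = begin-strict
  M                     ≡⟨ m≡m%n+[m/n]*n M g ⟩
  M % g + M / g * g     <⟨ +-monoˡ-< (M / g * g) (m%n<n M g) ⟩
  g + M / g * g         ∎
  where open ≤-Reasoning

module GapThreshold (a b : ℕ) where

  Level : Bool → ℕ → Set
  Level true  w = a ≤ w
  Level false w = w ≤ b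

  gapThr-level : ∀ {v} (x : Input n) → gapThr a b x ≡ just v → Level v ∣ x ∣
  gapThr-level x fx
    with a ≤ᵇ ∣ x ∣ | ≤ᵇ-reflects-≤ a ∣ x ∣ | ∣ x ∣ ≤ᵇ b | ≤ᵇ-reflects-≤ ∣ x ∣ b
  gapThr-level x refl | true  | ofʸ a≤w | _     | _        = a≤w
  gapThr-level x refl | false | _       | true  | ofʸ w≤b  = w≤b
  gapThr-level x ()   | false | _       | false | _

  sensitive-level : ∀ {v} (x B : Input n) →
                    gapThr a b x ≡ just v → Sensitive (gapThr a b) x B →
                    Level (not v) ∣ flip x B ∣
  sensitive-level x B fx (u , fx′ , fxB) rewrite just-injective (trans (sym fx) fx′) =
    gapThr-level (flip x B) fxB

  module _ (b<a : b < a) where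

    level-gapThr : ∀ v (x : Input n) → Level v ∣ x ∣ → gapThr a b x ≡ just v
    level-gapThr v x lvl
      with a ≤ᵇ ∣ x ∣ | ≤ᵇ-reflects-≤ a ∣ x ∣ | ∣ x ∣ ≤ᵇ b | ≤ᵇ-reflects-≤ ∣ x ∣ b | v
    ... | true  | _       | _     | _       | true  = refl
    ... | true  | ofʸ a≤w | _     | _       | false = contradiction (≤-<-trans lvl b<a) (≤⇒≯ a≤w)
    ... | false | ofⁿ a≰w | _     | _       | true  = contradiction lvl a≰w
    ... | false | _       | true  | _       | false = refl
    ... | false | _       | false | ofⁿ w≰b | false = contradiction lvl w≰b

    -- On an input of weight w ≥ a, each sensitive block contains at least
    -- w - b ones of x; packing these gives t * g ≤ a.
    upper-at-one : ∀ {t} (x : Input n) {Bs} → gapThr a b x ≡ just true →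
                   SensitiveFamily (gapThr a b) x t Bs → t * (a ∸ b) ≤ a
    upper-at-one {t = t} x {Bs} fx (disj , sens) =
      cancel-excess t (a ∸ b) (w ∸ a) a (subst₂ (λ d e → t * d ≤ e) excess (sym (m+[n∸m]≡n a≤w)) packed)
      where
      w : ℕ
      w = ∣ x ∣
      a≤w : a ≤ w
      a≤w = gapThr-level x fx
      ones : ∀ i → w ∸ b ≤ ∣ x ∩ Bs i ∣
      ones i = m≤n+o⇒m∸n≤o w b (begin
        w                               ≤⟨ m≤m+n w _ ⟩
        w + ∣ ∁ x ∩ Bs i ∣              ≡⟨ flip-weight x (Bs i) ⟨
        ∣ flip x (Bs i) ∣ + ∣ x ∩ Bs i ∣ ≤⟨ +-monoˡ-≤ _ (sensitive-level x (Bs i) fx (sens i)) ⟩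
        b + ∣ x ∩ Bs i ∣                ∎)
        where open ≤-Reasoning
      packed : t * (w ∸ b) ≤ w
      packed = packing t (w ∸ b) x Bs disj ones
      excess : w ∸ b ≡ (a ∸ b) + (w ∸ a)
      excess = trans (∸-split (<⇒≤ b<a) a≤w) (+-comm (w ∸ a) (a ∸ b))

    -- On an input of weight w ≤ b, each sensitive block contains at least
    -- a - w zeros of x; packing these inside ∁ x gives t * g ≤ n - b.
    upper-at-zero : ∀ {t} (x : Input n) {Bs} → a ≤ n → gapThr a b x ≡ just false →
                    SensitiveFamily (gapThr a b) x t Bs → t * (a ∸ b) ≤ n ∸ b
    upper-at-zero {n} {t} x {Bs} a≤n fx (disj , sens) =
      cancel-excess t (a ∸ b) (b ∸ w) (n ∸ b)
        (subst₂ (λ d e → t * d ≤ e) (∸-split w≤b (<⇒≤ b<a)) (∸-split w≤b (≤-trans (<⇒≤ b<a) a≤n)) packed)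
      where
      w : ℕ
      w = ∣ x ∣
      w≤b : w ≤ b
      w≤b = gapThr-level x fx
      zeros : ∀ i → a ∸ w ≤ ∣ ∁ x ∩ Bs i ∣
      zeros i = m≤n+o⇒m∸n≤o a w (begin
        a                               ≤⟨ sensitive-level x (Bs i) fx (sens i) ⟩
        ∣ flip x (Bs i) ∣               ≤⟨ m≤m+n _ _ ⟩
        ∣ flip x (Bs i) ∣ + ∣ x ∩ Bs i ∣ ≡⟨ flip-weight x (Bs i) ⟩
        w + ∣ ∁ x ∩ Bs i ∣              ∎)
        where open ≤-Reasoning
      packed : t * (a ∸ w) ≤ n ∸ w
      packed = subst (t * (a ∸ w) ≤_) (∣∁p∣≡n∸∣p∣ x) (packing t (a ∸ w) (∁ x) Bs disj zeros)

    upper : ∀ {t} (x : Input n) → a ≤ n → BsAtLeast (gapThr a b) x t →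
            t * (a ∸ b) ≤ a ⊎ t * (a ∸ b) ≤ n ∸ b
    upper {t = zero}  _ _   _                   = inj₁ z≤n
    upper {t = suc t} x a≤n (Bs , disj , sens) with sens zero
    ... | true  , fx , _ = inj₁ (upper-at-one x fx (disj , sens))
    ... | false , fx , _ = inj₂ (upper-at-zero x a≤n fx (disj , sens))

    Witness : (n t : ℕ) → Set
    Witness n t = Σ (Input n) λ x → Σ Bool (λ v → gapThr a b x ≡ just v) × BsAtLeast (gapThr a b) x t

    -- If q * g ≤ a, an input of weight a has q disjoint blocks of g ones; flipping
    -- any of them lowers the weight to b, so all of them are sensitive.
    lower-at-one : ∀ q → a ≤ n → q * (a ∸ b) ≤ a → Witness n q
    lower-at-one q a≤n room with input-of-weight a a≤n
    ... | x , ∣x∣≡a with blocks q (a ∸ b) x (subst (q * (a ∸ b) ≤_) (sym ∣x∣≡a) room)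
    ... | Bs , disj , size = x , (true , fx) , Bs , disj , sensitive
      where
      fx : gapThr a b x ≡ just true
      fx = level-gapThr true x (≤-reflexive (sym ∣x∣≡a))
      sensitive : ∀ i → Sensitive (gapThr a b) x (Bs i)
      sensitive i = true , fx , level-gapThr false (flip x (Bs i)) (≤-reflexive lowered)
        where
        lowered : ∣ flip x (Bs i) ∣ ≡ b
        lowered = +-cancelʳ-≡ (a ∸ b) _ _ (begin
          ∣ flip x (Bs i) ∣ + (a ∸ b)     ≡⟨ cong (∣ flip x (Bs i) ∣ +_) (proj₂ (size i)) ⟨
          ∣ flip x (Bs i) ∣ + ∣ Bs i ∣    ≡⟨ flip-⊆ (proj₁ (size i)) ⟩
          ∣ x ∣                           ≡⟨ ∣x∣≡a ⟩
          a                               ≡⟨ m+[n∸m]≡n (<⇒≤ b<a) ⟨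
          b + (a ∸ b)                     ∎)
          where open ≡-Reasoning

    -- If q * g ≤ n - b, an input of weight b has q disjoint blocks of g zeros;
    -- flipping any of them raises the weight to a, so all of them are sensitive.
    lower-at-zero : ∀ q → b ≤ n → q * (a ∸ b) ≤ n ∸ b → Witness n q
    lower-at-zero {n} q b≤n room with input-of-weight b b≤n
    ... | x , ∣x∣≡b with blocks q (a ∸ b) (∁ x) (subst (q * (a ∸ b) ≤_) ∣∁x∣ room)
      where
      ∣∁x∣ : n ∸ b ≡ ∣ ∁ x ∣
      ∣∁x∣ = sym (trans (∣∁p∣≡n∸∣p∣ x) (cong (n ∸_) ∣x∣≡b))
    ... | Bs , disj , size = x , (false , fx) , Bs , disj , sensitive
      where
      fx : gapThr a b x ≡ just false
      fx = level-gapThr false x (≤-reflexive ∣x∣≡b)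
      sensitive : ∀ i → Sensitive (gapThr a b) x (Bs i)
      sensitive i = false , fx , level-gapThr true (flip x (Bs i)) (≤-reflexive (sym raised))
        where
        raised : ∣ flip x (Bs i) ∣ ≡ a
        raised = begin
          ∣ flip x (Bs i) ∣               ≡⟨ flip-⊆∁ (proj₁ (size i)) ⟩
          ∣ x ∣ + ∣ Bs i ∣                ≡⟨ cong₂ _+_ ∣x∣≡b (proj₂ (size i)) ⟩
          b + (a ∸ b)                     ≡⟨ m+[n∸m]≡n (<⇒≤ b<a) ⟩
          a                               ∎
          where open ≡-Reasoning

module Exact (n a b : ℕ) (b<a : b < a) (a≤n : a ≤ n) where
  open GapThreshold a b

  g : ℕ
  g = a ∸ b

  instance
    g≢0 : NonZero g
    g≢0 = >-nonZero (m<n⇒0<n∸m b<a)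

  q₁ q₀ k : ℕ
  q₁ = a / g
  q₀ = (n ∸ b) / g
  k  = q₁ ⊔ q₀

  b≤n : b ≤ n
  b≤n = ≤-trans (<⇒≤ b<a) a≤n

  isBS : IsBS (gapThr a b) k
  isBS = witness , maximal
    where
    witness : Witness b<a n k
    witness with ⊔-sel q₁ q₀
    ... | inj₁ k≡q₁ = lower-at-one b<a k a≤n (subst (λ q → q * g ≤ a) (sym k≡q₁) (m/n*n≤m a g))
    ... | inj₂ k≡q₀ = lower-at-zero b<a k b≤n (subst (λ q → q * g ≤ n ∸ b) (sym k≡q₀) (m/n*n≤m (n ∸ b) g))
    maximal : ∀ (x : Input n) t → BsAtLeast (gapThr a b) x t → t ≤ k
    maximal x t bs with upper b<a x a≤n bs
    ... | inj₁ tg≤a  = ≤-trans (≤-quotient t g a tg≤a) (m≤m⊔n q₁ q₀)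
    ... | inj₂ tg≤n-b = ≤-trans (≤-quotient t g (n ∸ b) tg≤n-b) (m≤n⊔m q₁ q₀)

  -- g * k ≤ n: both quotients times g stay below n.
  gk≤n : g * k ≤ 1 * n
  gk≤n = begin
    g * k                 ≡⟨ *-comm g k ⟩
    k * g                 ≡⟨ *-distribʳ-⊔ g q₁ q₀ ⟩
    q₁ * g ⊔ q₀ * g       ≤⟨ ⊔-mono-≤ (m/n*n≤m a g) (m/n*n≤m (n ∸ b) g) ⟩
    a ⊔ (n ∸ b)           ≤⟨ ⊔-lub a≤n (m∸n≤m n b) ⟩
    n                     ≡⟨ *-identityˡ n ⟨
    1 * n                 ∎
    where open ≤-Reasoning

  -- n ≤ 4 g k: both a and n - b exceed a multiple of g ≤ g k by less than g ≤ g k.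
  n≤4gk : n ≤ 4 * (g * k)
  n≤4gk = begin
    n                                 ≤⟨ m≤n+m∸n n b ⟩
    b + (n ∸ b)                       ≤⟨ +-monoˡ-≤ (n ∸ b) (<⇒≤ b<a) ⟩
    a + (n ∸ b)                       ≤⟨ +-mono-≤ (<⇒≤ (<quotient-succ a g)) (<⇒≤ (<quotient-succ (n ∸ b) g)) ⟩
    (g + q₁ * g) + (g + q₀ * g)       ≤⟨ +-mono-≤ (+-mono-≤ g≤kg (*-monoˡ-≤ g (m≤m⊔n q₁ q₀)))
                                                  (+-mono-≤ g≤kg (*-monoˡ-≤ g (m≤n⊔m q₁ q₀))) ⟩
    (k * g + k * g) + (k * g + k * g) ≡⟨ four-times (k * g) ⟩
    4 * (k * g)                       ≡⟨ cong (4 *_) (*-comm k g) ⟩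
    4 * (g * k)                       ∎
    where
    open ≤-Reasoning
    g≤kg : g ≤ k * g
    g≤kg = subst (_≤ k * g) (*-identityˡ g) (*-monoˡ-≤ g (≤-trans (m≥n⇒m/n>0 (m∸n≤m a b)) (m≤m⊔n q₁ q₀)))
    four-times : ∀ m → (m + m) + (m + m) ≡ 4 * m
    four-times = solve-∀

lemma1 : Σ ℕ λ C → Σ ℕ λ D → (0 < C) × (0 < D) ×
           (∀ (n a b : ℕ) → b < a → a ≤ n →
             Σ ℕ λ k → IsBS {n} (gapThr a b) k
               × (n ≤ C * ((a ∸ b) * k))
               × ((a ∸ b) * k ≤ D * n))
lemma1 = 4 , 1 , s≤s z≤n , s≤s z≤n , λ n a b b<a a≤n →
  let open Exact n a b b<a a≤n in k , isBS , n≤4gk , gk≤n
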